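{- There are infinitely many mixed graphs with rank $2$ which are not determined by their spectrum.
   Context: A mixed graph $M_G$ is obtained from a finite simple graph $G$ by orienting the edges of some subset of $E(G)$. With $\omega=\frac{1+\mathbf{i}\sqrt3}{2}$, $N(M_G)$ has $(u,v)$-entry $\omega$ if $\overrightarrow{uv}$ is an arc, $\bar\omega$ if $\overrightarrow{vu}$ is an arc, $1$ for an undirected edge, $0$ otherwise; rank and spectrum of $M_G$ are those of $N(M_G)$. Let $\mathbb{T}_6=\{\pm1,\pm\omega,\pm\bar\omega\}$. Given a partition $V(M_G)=\bigcup_{j\in\mathbb{T}_6}V_j$, an edge $xy$ has type $(j,k)$ if $x\in V_j,y\in V_k$; the partition is admissible if each undirected edge has type $(j,j)$ or $(j,\omega j)$ and each arc has type $(j,j)$, $(j,\bar\omega j)$ or $(j,-\omega j)$ for some $j$. A three-way switching w.r.t. an admissible partition turns undirected edges of type $(j,\omega j)$ into arcs from $V_j$ to $V_{\omega j}$, arcs of type $(j,\bar\omega j)$ into undirected edges, and reverses arcs of type $(j,-\omega j)$. The converse reverses all arcs. Two mixed graphs are switching equivalent if one is obtained from the other (up to isomorphism) by a sequence of three-way switchings and taking converses. A mixed graph is determined by its spectrum if it is switching equivalent to every mixed graph cospectral with it. -}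

module Defs where

open import Data.Nat as ℕ using (ℕ; zero; suc; _≤_; _%_)
open import Data.Integer as ℤ using (ℤ; +_; -[1+_])
open import Data.Fin using (Fin; zero; suc; toℕ; punchIn)
open import Data.Fin.Permutation using (Permutation′; _⟨$⟩ʳ_)
open import Data.Product using (Σ; ∃; ∃-syntax; _×_; _,_)
open import Data.Sum using (_⊎_)
open import Data.Bool using (Bool; true; false; if_then_else_)
open import Function.Definitions using (Injective)
open import Relation.Binary.PropositionalEquality using (_≡_; _≢_)
open import Relation.Binary.Construct.Closure.ReflexiveTransitive using (Star)
open import Relation.Nullary using (¬_)

-- Eisenstein integers ℤ[ω], ω = (1 + i√3)/2, so ω² = ω - 1, ω̄ = 1 - ω.
-- The pair (a , b) represents a + bω.

Eis : Set
Eis = ℤ × ℤ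

0E 1E ωE ω̄E : Eis
0E  = (+ 0 , + 0)
1E  = (+ 1 , + 0)
ωE  = (+ 0 , + 1)
ω̄E = (+ 1 , -[1+ 0 ])

_+E_ : Eis → Eis → Eis
(a , b) +E (c , d) = (a ℤ.+ c , b ℤ.+ d)

-E_ : Eis → Eis
-E (a , b) = (ℤ.- a , ℤ.- b)

-- (a + bω)(c + dω) = (ac - bd) + (ad + bc + bd)ω
_*E_ : Eis → Eis → Eis
(a , b) *E (c , d) = (a ℤ.* c ℤ.- b ℤ.* d , a ℤ.* d ℤ.+ b ℤ.* c ℤ.+ b ℤ.* d)

record RingOps : Set₁ where
  field
    C    : Set
    zr   : C
    one  : C
    plus : C → C → C
    mul  : C → C → C
    neg  : C → C

module _ (R : RingOps) where
  open RingOps R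

  signed : ℕ → C → C
  signed zero    x = x
  signed (suc k) x = neg (signed k x)

  sumFin : (n : ℕ) → (Fin n → C) → C
  sumFin zero    f = zr
  sumFin (suc n) f = plus (f zero) (sumFin n (λ j → f (suc j)))

  det : (n : ℕ) → (Fin n → Fin n → C) → C
  det zero    M = one
  det (suc n) M =
    sumFin (suc n) (λ j → signed (toℕ j)
      (mul (M zero j) (det n (λ i k → M (suc i) (punchIn j k)))))

EisOps : RingOps
EisOps = record { C = Eis ; zr = 0E ; one = 1E ; plus = _+E_ ; mul = _*E_ ; neg = -E_ }

-- Polynomials over ℤ[ω] as coefficient sequences (coefficient of x^k).

Poly : Set
Poly = ℕ → Eis

sumUpTo : ℕ → (ℕ → Eis) → Eis
sumUpTo zero    f = f 0
sumUpTo (suc k) f = sumUpTo k f +E f (suc k)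

PolyOps : RingOps
PolyOps = record
  { C    = Poly
  ; zr   = λ _ → 0E
  ; one  = λ { zero → 1E ; (suc _) → 0E }
  ; plus = λ p q k → p k +E q k
  ; mul  = λ p q k → sumUpTo k (λ i → p i *E q (k ℕ.∸ i))
  ; neg  = λ p k → -E p k
  }

constP : Eis → Poly
constP a zero    = a
constP a (suc _) = 0E

varX : Poly
varX (suc zero) = 1E
varX _          = 0E

-- Mixed graphs on vertex set Fin n.
-- lab x y = none : no edge; und : undirected edge xy;
-- out : arc x → y ; inn : arc y → x.

data Label : Set where
  none und out inn : Label

flipL : Label → Label
flipL none = none
flipL und  = und
flipL out  = inn
flipL inn  = out

Labelling : ℕ → Set
Labelling n = Fin n → Fin n → Label

IsMixedGraph : {n : ℕ} → Labelling n → Set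
IsMixedGraph {n} G = (∀ x → G x x ≡ none) × (∀ x y → G y x ≡ flipL (G x y))

entry : Label → Eis
entry none = 0E
entry und  = 1E
entry out  = ωE
entry inn  = ω̄E

N : {n : ℕ} → Labelling n → Fin n → Fin n → Eis
N G x y = entry (G x y)

_==F_ : {n : ℕ} → Fin n → Fin n → Bool
zero  ==F zero  = true
suc i ==F suc j = i ==F j
_     ==F _     = false

charPoly : {n : ℕ} → Labelling n → Poly
charPoly {n} G = det PolyOps n (λ i j →
  RingOps.plus PolyOps (if i ==F j then varX else constP 0E) (constP (-E N G i j)))

-- cospectral: same spectrum, i.e. same characteristic polynomial
Cospectral : {n : ℕ} → Labelling n → Labelling n → Set
Cospectral G H = ∀ k → charPoly G k ≡ charPoly H k

-- rank (over the field ℚ(ω)) as determinantal rank: some r×r minor is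
-- nonzero and every (r+1)×(r+1) minor vanishes.
minor : {n : ℕ} (r : ℕ) → (Fin n → Fin n → Eis) → (Fin r → Fin n) → (Fin r → Fin n) → Eis
minor r M ρ κ = det EisOps r (λ i j → M (ρ i) (κ j))

HasRank : {n : ℕ} → (Fin n → Fin n → Eis) → ℕ → Set
HasRank {n} M r =
  (∃[ ρ ] ∃[ κ ] (Injective _≡_ _≡_ ρ × Injective _≡_ _≡_ κ × minor r M ρ κ ≢ 0E))
  × (∀ (ρ κ : Fin (suc r) → Fin n) → Injective _≡_ _≡_ ρ → Injective _≡_ _≡_ κ →
       minor (suc r) M ρ κ ≡ 0E)

Rank : {n : ℕ} → Labelling n → ℕ → Set
Rank G r = HasRank (N G) r

-- Three-way switching.  T₆ = {ω^a : a ∈ Fin 6}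
-- (ω^0 = 1, ω^1 = ω, ω^2 = -ω̄, ω^3 = -1, ω^4 = -ω, ω^5 = ω̄).
-- A partition assigns to each vertex x the exponent p x with x ∈ V_{ω^(p x)}.

Partition : ℕ → Set
Partition n = Fin n → Fin 6

-- exponent difference: ω^(d a b) = ω^b / ω^a, i.e. d = (b - a) mod 6
d : Fin 6 → Fin 6 → ℕ
d a b = (toℕ b ℕ.+ 6 ℕ.∸ toℕ a) % 6

-- undirected edge type (j,j) or (j,ωj) (in some order);
-- arc x→y of type (j,j), (j,ω̄j) or (j,-ωj).
AdmissibleLabel : ℕ → Label → Set
AdmissibleLabel k none = Data.Unit.⊤ where import Data.Unit
AdmissibleLabel k und  = (k ≡ 0) ⊎ (k ≡ 1) ⊎ (k ≡ 5)
AdmissibleLabel k out  = (k ≡ 0) ⊎ (k ≡ 5) ⊎ (k ≡ 4)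
AdmissibleLabel k inn  = (k ≡ 0) ⊎ (k ≡ 1) ⊎ (k ≡ 2)

Admissible : {n : ℕ} → Labelling n → Partition n → Set
Admissible G p = ∀ x y → AdmissibleLabel (d (p x) (p y)) (G x y)

switchLabel : Label → ℕ → Label
switchLabel und 1 = out    -- type (j,ωj): becomes arc V_j → V_ωj
switchLabel und 5 = inn    -- same, seen from the other endpoint
switchLabel und _ = und
switchLabel out 5 = und    -- arc of type (j,ω̄j) becomes undirected
switchLabel out 4 = inn    -- arc of type (j,-ωj) is reversed
switchLabel out _ = out
switchLabel inn 1 = und    -- arc y→x of type (j,ω̄j)
switchLabel inn 2 = out    -- arc y→x of type (j,-ωj)
switchLabel inn _ = inn
switchLabel none _ = none

switch : {n : ℕ} → Partition n → Labelling n → Labelling n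
switch p G x y = switchLabel (G x y) (d (p x) (p y))

converse : {n : ℕ} → Labelling n → Labelling n
converse G x y = flipL (G x y)

data Step {n : ℕ} (G H : Labelling n) : Set where
  switching : (p : Partition n) → Admissible G p →
              (∀ x y → H x y ≡ switch p G x y) → Step G H
  conv      : (∀ x y → H x y ≡ converse G x y) → Step G H
  iso       : (σ : Permutation′ n) →
              (∀ x y → H (σ ⟨$⟩ʳ x) (σ ⟨$⟩ʳ y) ≡ G x y) → Step G H

SwitchingEquivalent : {n : ℕ} → Labelling n → Labelling n → Set
SwitchingEquivalent G H = Star Step G H ⊎ Star Step H G

DeterminedBySpectrum : {n : ℕ} → Labelling n → Set
DeterminedBySpectrum {n} G =
  ∀ (H : Labelling n) → IsMixedGraph H → Cospectral G H → SwitchingEquivalent G H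

{-# OPTIONS --safe #-}
-- The graphs C₄ ∪ (k + 1) K₁ and K₁,₄ ∪ k K₁ are cospectral: for k = 0 both have
-- characteristic polynomial x⁵ − 4x³, and every further isolated vertex multiplies it by x.
-- Both are blow-ups of K₂ ∪ K₁, so every 3 × 3 minor of their adjacency matrices vanishes,
-- while an edge gives a nonzero 2 × 2 minor. Three-way switchings, converses and isomorphisms
-- never change the underlying simple graph up to isomorphism, yet the star has a vertex of
-- degree 4 and the square has maximum degree 2.
module Submission where

open import Defs
open import Data.Nat using (ℕ; _≤_)
open import Data.Product using (Σ; ∃-syntax; _×_)
open import Relation.Nullary using (¬_)

open import Data.Nat as ℕ using (zero; suc; _+_; _∸_; _<_; s≤s; _<?_)
open import Data.Nat.Properties using (≤-<-trans; m≤n+m; m≤m+n; ≮⇒≥; ≰⇒>)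
import Data.Integer.Properties as ℤ
open import Data.Fin using (Fin; zero; suc; toℕ; fromℕ<; punchIn; _↑ʳ_; _↑ˡ_; _≟_)
open import Data.Fin.Patterns using (0F; 1F; 2F; 3F; 4F; 5F)
open import Data.Fin.Properties using (toℕ-fromℕ<; ↑ʳ-injective; ↑ˡ-injective; all?; any?)
open import Data.Fin.Permutation using (_⟨$⟩ʳ_; _⟨$⟩ˡ_; inverseʳ; flip)
open import Data.Vec.Functional using (Vector; _∷_; [])
open import Data.Product using (_,_)
open import Data.Product.Properties using (≡-dec)
open import Data.Sum using (inj₁; inj₂)
open import Data.Bool using (true; false; if_then_else_)
open import Data.Empty using (⊥-elim)
open import Function using (_∘_; id)
open import Function.Bundles using (Injection)
open import Function.Definitions using (Injective)
open import Function.Properties.Inverse using (↔⇒↣)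
import Function.Construct.Composition as Compose
open import Relation.Nullary using (Dec; yes; no; ¬?; _×-dec_)
open import Relation.Nullary.Decidable using (toWitness; toWitnessFalse)
open import Relation.Binary.PropositionalEquality
open import Relation.Binary.Construct.Closure.ReflexiveTransitive using (fold)

private
  variable
    m n : ℕ

+E-identityʳ : ∀ a → a +E 0E ≡ a
+E-identityʳ (x , y) = cong₂ _,_ (ℤ.+-identityʳ x) (ℤ.+-identityʳ y)

*E-zeroʳ : ∀ a → a *E 0E ≡ 0E
*E-zeroʳ (x , y) rewrite ℤ.*-zeroʳ x | ℤ.*-zeroʳ y = refl

_≟E_ : (a b : Eis) → Dec (a ≡ b)
_≟E_ = ≡-dec ℤ._≟_ ℤ._≟_

module _ (R : RingOps) where
  open RingOps R

  sumFin-cong : ∀ n {f g : Fin n → C} → (∀ j → f j ≡ g j) → sumFin R n f ≡ sumFin R n g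
  sumFin-cong zero    f≡g = refl
  sumFin-cong (suc n) f≡g = cong₂ plus (f≡g zero) (sumFin-cong n (f≡g ∘ suc))

  det-cong : ∀ n {M M′ : Fin n → Fin n → C} → (∀ i j → M i j ≡ M′ i j) → det R n M ≡ det R n M′
  det-cong zero    M≡M′ = refl
  det-cong (suc n) M≡M′ = sumFin-cong (suc n) λ j → cong (signed R (toℕ j))
    (cong₂ mul (M≡M′ zero j) (det-cong n λ i k → M≡M′ (suc i) (punchIn j k)))

infixl 6 _+P_
infixl 7 _*P_
infix 4 _≈P_

_+P_ _*P_ : Poly → Poly → Poly
_+P_ = RingOps.plus PolyOps
_*P_ = RingOps.mul PolyOps

0P : Poly
0P _ = 0E

_≈P_ : Poly → Poly → Set
p ≈P q = ∀ k → p k ≡ q k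

sumUpTo-cong : ∀ k {f g : ℕ → Eis} → (∀ i → f i ≡ g i) → sumUpTo k f ≡ sumUpTo k g
sumUpTo-cong zero    f≡g = f≡g 0
sumUpTo-cong (suc k) f≡g = cong₂ _+E_ (sumUpTo-cong k f≡g) (f≡g (suc k))

sumUpTo-zero : ∀ k {f : ℕ → Eis} → (∀ i → f i ≡ 0E) → sumUpTo k f ≡ 0E
sumUpTo-zero zero    f≡0 = f≡0 0
sumUpTo-zero (suc k) f≡0 rewrite sumUpTo-zero k f≡0 | f≡0 (suc k) = refl

*P-congˡ : ∀ {p p′} q → p ≈P p′ → p *P q ≈P p′ *P q
*P-congˡ q p≈p′ k = sumUpTo-cong k λ i → cong (_*E q (k ∸ i)) (p≈p′ i)

*P-congʳ : ∀ p {q q′} → q ≈P q′ → p *P q ≈P p *P q′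
*P-congʳ p q≈q′ k = sumUpTo-cong k λ i → cong (p i *E_) (q≈q′ (k ∸ i))

*P-zeroˡ : ∀ {p} q → p ≈P 0P → p *P q ≈P 0P
*P-zeroˡ q p≈0 k = sumUpTo-zero k λ i → cong (_*E q (k ∸ i)) (p≈0 i)

signed-zero : ∀ s {p} → p ≈P 0P → signed PolyOps s p ≈P 0P
signed-zero zero    p≈0 k = p≈0 k
signed-zero (suc s) p≈0 k rewrite signed-zero s p≈0 k = refl

sumFin-zero : ∀ n {f : Fin n → Poly} → (∀ j → f j ≈P 0P) → sumFin PolyOps n f ≈P 0P
sumFin-zero zero    f≈0 k = refl
sumFin-zero (suc n) f≈0 k rewrite f≈0 zero k | sumFin-zero n (f≈0 ∘ suc) k = refl

det-firstRow : ∀ n (M : Fin (suc n) → Fin (suc n) → Poly) → (∀ j → M zero (suc j) ≈P 0P) →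
               det PolyOps (suc n) M ≈P M zero zero *P det PolyOps n (λ i j → M (suc i) (suc j))
det-firstRow n M row≈0 k = trans
  (cong ((M zero zero *P det PolyOps n (λ i j → M (suc i) (suc j))) k +E_)
    (sumFin-zero n (λ j → signed-zero (suc (toℕ j)) (*P-zeroˡ (cofactor j) (row≈0 j))) k))
  (+E-identityʳ _)
  where
  cofactor : Fin n → Poly
  cofactor j = det PolyOps n (λ i k → M (suc i) (punchIn (suc j) k))

Degree≤ : ℕ → Poly → Set
Degree≤ n p = ∀ k → n < k → p k ≡ 0E

+P-degree≤ : ∀ {n p q} → Degree≤ n p → Degree≤ n q → Degree≤ n (p +P q)
+P-degree≤ p≤ q≤ k n<k rewrite p≤ k n<k | q≤ k n<k = refl

m+n<o∧l≤m⇒n<o∸l : ∀ m n o l → m + n < o → l ≤ m → n < o ∸ l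
m+n<o∧l≤m⇒n<o∸l m       n o       zero    m+n<o       _         = ≤-<-trans (m≤n+m n m) m+n<o
m+n<o∧l≤m⇒n<o∸l (suc m) n (suc o) (suc l) (s≤s m+n<o) (s≤s l≤m) = m+n<o∧l≤m⇒n<o∸l m n o l m+n<o l≤m

*P-degree≤ : ∀ a b {p q} → Degree≤ a p → Degree≤ b q → Degree≤ (a + b) (p *P q)
*P-degree≤ a b {p} {q} p≤ q≤ k a+b<k = sumUpTo-zero k term
  where
  term : ∀ i → p i *E q (k ∸ i) ≡ 0E
  term i with a <? i
  ... | yes a<i rewrite p≤ i a<i = refl
  ... | no  a≮i rewrite q≤ (k ∸ i) (m+n<o∧l≤m⇒n<o∸l a b k i a+b<k (≮⇒≥ a≮i)) = *E-zeroʳ (p i)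

signed-degree≤ : ∀ {n} s {p} → Degree≤ n p → Degree≤ n (signed PolyOps s p)
signed-degree≤ zero    p≤ = p≤
signed-degree≤ (suc s) p≤ k n<k rewrite signed-degree≤ s p≤ k n<k = refl

sumFin-degree≤ : ∀ {d} n {f : Fin n → Poly} → (∀ j → Degree≤ d (f j)) → Degree≤ d (sumFin PolyOps n f)
sumFin-degree≤ zero    f≤ k d<k = refl
sumFin-degree≤ (suc n) f≤ k d<k rewrite f≤ zero k d<k | sumFin-degree≤ n (f≤ ∘ suc) k d<k = refl

det-degree≤ : ∀ n M → (∀ i j → Degree≤ 1 (M i j)) → Degree≤ n (det PolyOps n M)
det-degree≤ zero    M M≤1 (suc k) _ = refl
det-degree≤ (suc n) M M≤1 = sumFin-degree≤ (suc n) λ j → signed-degree≤ (toℕ j)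
  (*P-degree≤ 1 n (M≤1 zero j) (det-degree≤ n _ λ i k → M≤1 (suc i) (punchIn j k)))

charPoly-degree≤ : (L : Labelling n) → Degree≤ n (charPoly L)
charPoly-degree≤ {n} L = det-degree≤ n _ λ i j → +P-degree≤ (diagonal≤1 (i ==F j)) (constP≤1 _)
  where
  constP≤1 : ∀ a → Degree≤ 1 (constP a)
  constP≤1 a (suc k) _ = refl

  diagonal≤1 : ∀ b → Degree≤ 1 (if b then varX else constP 0E)
  diagonal≤1 false = constP≤1 0E
  diagonal≤1 true  (suc (suc k)) _         = refl
  diagonal≤1 true  (suc zero)    (s≤s ())

constP-0E : constP 0E ≈P 0P
constP-0E zero    = refl
constP-0E (suc k) = refl

+P-constP-0E : ∀ p → p +P constP 0E ≈P p
+P-constP-0E p zero    = +E-identityʳ (p zero)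
+P-constP-0E p (suc k) = +E-identityʳ (p (suc k))

charMatrix : Labelling n → Fin n → Fin n → Poly
charMatrix L i j = (if i ==F j then varX else constP 0E) +P constP (-E N L i j)

delete₀ : Labelling (suc n) → Labelling n
delete₀ L x y = L (suc x) (suc y)

charPoly-isolated₀ : (L : Labelling (suc n)) → (∀ y → L zero y ≡ none) →
                     charPoly L ≈P varX *P charPoly (delete₀ L)
charPoly-isolated₀ {n} L isolated k = trans
  (det-firstRow n (charMatrix L) offDiagonal≈0 k)
  (*P-congˡ (charPoly (delete₀ L)) diagonal≈X k)
  where
  diagonal≈X : varX +P constP (-E N L zero zero) ≈P varX
  diagonal≈X rewrite isolated zero = +P-constP-0E varX

  offDiagonal≈0 : ∀ j → constP 0E +P constP (-E N L zero (suc j)) ≈P 0P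
  offDiagonal≈0 j k rewrite isolated (suc j) = trans (+P-constP-0E (constP 0E) k) (constP-0E k)

cospectral-isolated₀ : {G H : Labelling (suc n)} →
                       (∀ y → G zero y ≡ none) → (∀ y → H zero y ≡ none) →
                       Cospectral (delete₀ G) (delete₀ H) → Cospectral G H
cospectral-isolated₀ {G = G} {H} G-isolated H-isolated cospectral k = begin
  charPoly G k                      ≡⟨ charPoly-isolated₀ G G-isolated k ⟩
  (varX *P charPoly (delete₀ G)) k  ≡⟨ *P-congʳ varX cospectral k ⟩
  (varX *P charPoly (delete₀ H)) k  ≡⟨ charPoly-isolated₀ H H-isolated k ⟨
  charPoly H k                      ∎
  where open ≡-Reasoning

cospectral-fromCoefficients≤ : (G H : Labelling n) →
  (∀ (k : Fin (suc n)) → charPoly G (toℕ k) ≡ charPoly H (toℕ k)) → Cospectral G H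
cospectral-fromCoefficients≤ {n} G H low k with k ℕ.≤? n
... | yes k≤n = subst (λ i → charPoly G i ≡ charPoly H i) (toℕ-fromℕ< (s≤s k≤n)) (low (fromℕ< (s≤s k≤n)))
... | no  k≰n = trans (charPoly-degree≤ G k (≰⇒> k≰n)) (sym (charPoly-degree≤ H k (≰⇒> k≰n)))

blowUp : Labelling m → (Fin n → Fin m) → Labelling n
blowUp T c x y = T (c x) (c y)

blowUp-isMixedGraph : {T : Labelling m} → IsMixedGraph T → (c : Fin n → Fin m) →
                      IsMixedGraph (blowUp T c)
blowUp-isMixedGraph (irreflexive , flipped) c = irreflexive ∘ c , λ x y → flipped (c x) (c y)

pad : ∀ {a} {A : Set a} (k : ℕ) → A → Vector A n → Vector A (k + n)
pad zero    a c = c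
pad (suc k) a c = a ∷ pad k a c

pad-↑ʳ : ∀ {a} {A : Set a} k (x : A) (c : Vector A n) i → pad k x c (k ↑ʳ i) ≡ c i
pad-↑ʳ zero    x c i = refl
pad-↑ʳ (suc k) x c i = pad-↑ʳ k x c i

blowUp-pad-↑ʳ : (T : Labelling m) → ∀ k o (c : Vector (Fin m) n) x y →
                blowUp T (pad k o c) (k ↑ʳ x) (k ↑ʳ y) ≡ blowUp T c x y
blowUp-pad-↑ʳ T k o c x y = cong₂ T (pad-↑ʳ k o c x) (pad-↑ʳ k o c y)

cospectral-pad : (T : Labelling m) (o : Fin m) → (∀ j → T o j ≡ none) → ∀ k {c c′ : Vector (Fin m) n} →
                 Cospectral (blowUp T c) (blowUp T c′) →
                 Cospectral (blowUp T (pad k o c)) (blowUp T (pad k o c′))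
cospectral-pad T o isolated zero    = id
-- G and H are given explicitly: inferring them would make Agda unfold the determinants.
cospectral-pad T o isolated (suc k) {c} {c′} =
  cospectral-isolated₀ {G = blowUp T (pad (suc k) o c)} {H = blowUp T (pad (suc k) o c′)}
    (isolated ∘ pad (suc k) o c) (isolated ∘ pad (suc k) o c′)
  ∘ cospectral-pad T o isolated k

minor-pad : (T : Labelling m) → ∀ k o (c : Vector (Fin m) n) r (ρ κ : Fin r → Fin n) →
            minor r (N (blowUp T (pad k o c))) ((k ↑ʳ_) ∘ ρ) ((k ↑ʳ_) ∘ κ) ≡ minor r (N (blowUp T c)) ρ κ
minor-pad T k o c r ρ κ = det-cong EisOps r λ i j → cong entry (blowUp-pad-↑ʳ T k o c (ρ i) (κ j))

K₂∪K₁ : Labelling 3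
K₂∪K₁ 1F 2F = und
K₂∪K₁ 2F 1F = und
K₂∪K₁ _  _  = none

K₂∪K₁-isMixedGraph : IsMixedGraph K₂∪K₁
K₂∪K₁-isMixedGraph = (λ { 0F → refl ; 1F → refl ; 2F → refl }) , λ
  { 0F 0F → refl ; 0F 1F → refl ; 0F 2F → refl
  ; 1F 0F → refl ; 1F 1F → refl ; 1F 2F → refl
  ; 2F 0F → refl ; 2F 1F → refl ; 2F 2F → refl }

-- A 3 × 3 minor of a blow-up only sees the classes of its rows and columns,
-- so it suffices to evaluate the 3⁶ class patterns.
K₂∪K₁-minor₃ : ∀ a₀ a₁ a₂ b₀ b₁ b₂ →
  det EisOps 3 (λ i j → N K₂∪K₁ ((a₀ ∷ a₁ ∷ a₂ ∷ []) i) ((b₀ ∷ b₁ ∷ b₂ ∷ []) j)) ≡ 0E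
K₂∪K₁-minor₃ = toWitness {a? = all? λ a₀ → all? λ a₁ → all? λ a₂ → all? λ b₀ → all? λ b₁ → all? λ b₂ →
  det EisOps 3 (λ i j → N K₂∪K₁ ((a₀ ∷ a₁ ∷ a₂ ∷ []) i) ((b₀ ∷ b₁ ∷ b₂ ∷ []) j)) ≟E 0E} _

blowUp-K₂∪K₁-minor₃ : (c : Fin n → Fin 3) (ρ κ : Fin 3 → Fin n) → minor 3 (N (blowUp K₂∪K₁ c)) ρ κ ≡ 0E
blowUp-K₂∪K₁-minor₃ c ρ κ =
  K₂∪K₁-minor₃ (c (ρ 0F)) (c (ρ 1F)) (c (ρ 2F)) (c (κ 0F)) (c (κ 1F)) (c (κ 2F))

Adjacent : Labelling n → Fin n → Fin n → Set
Adjacent L x y = L x y ≢ none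

HasDegree≥3 : Labelling n → Set
HasDegree≥3 L = ∃[ x ] ∃[ y₁ ] ∃[ y₂ ] ∃[ y₃ ]
  ((y₁ ≢ y₂ × y₁ ≢ y₃ × y₂ ≢ y₃) × (Adjacent L x y₁ × Adjacent L x y₂ × Adjacent L x y₃))

none? : (l : Label) → Dec (l ≡ none)
none? none = yes refl
none? und  = no λ ()
none? out  = no λ ()
none? inn  = no λ ()

hasDegree≥3? : (L : Labelling n) → Dec (HasDegree≥3 L)
hasDegree≥3? L = any? λ x → any? λ y₁ → any? λ y₂ → any? λ y₃ →
  (¬? (y₁ ≟ y₂) ×-dec ¬? (y₁ ≟ y₃) ×-dec ¬? (y₂ ≟ y₃)) ×-dec
  (¬? (none? (L x y₁)) ×-dec ¬? (none? (L x y₂)) ×-dec ¬? (none? (L x y₃)))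

hasDegree≥3-map : {L : Labelling n} {L′ : Labelling m} (f : Fin n → Fin m) → Injective _≡_ _≡_ f →
                  (∀ {x y} → Adjacent L x y → Adjacent L′ (f x) (f y)) →
                  HasDegree≥3 L → HasDegree≥3 L′
hasDegree≥3-map f f-injective adjacent (x , y₁ , y₂ , y₃ , (y₁≢y₂ , y₁≢y₃ , y₂≢y₃) , (a₁ , a₂ , a₃)) =
  f x , f y₁ , f y₂ , f y₃ ,
  (y₁≢y₂ ∘ f-injective , y₁≢y₃ ∘ f-injective , y₂≢y₃ ∘ f-injective) ,
  (adjacent a₁ , adjacent a₂ , adjacent a₃)

isolatedᵀ : {L : Labelling n} → IsMixedGraph L → ∀ {x} → (∀ y → L x y ≡ none) → ∀ y → L y x ≡ none
isolatedᵀ (_ , flipped) {x} isolated y = trans (flipped x y) (cong flipL (isolated y))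

hasDegree≥3-delete₀ : {L : Labelling (suc n)} → IsMixedGraph L → (∀ y → L zero y ≡ none) →
                      HasDegree≥3 L → HasDegree≥3 (delete₀ L)
hasDegree≥3-delete₀ _ isolated (zero , y₁ , _ , _ , _ , (a₁ , _)) = ⊥-elim (a₁ (isolated y₁))
hasDegree≥3-delete₀ mixed isolated (suc x , zero , _ , _ , _ , (a₁ , _)) =
  ⊥-elim (a₁ (isolatedᵀ mixed isolated (suc x)))
hasDegree≥3-delete₀ mixed isolated (suc x , suc _ , zero , _ , _ , (_ , a₂ , _)) =
  ⊥-elim (a₂ (isolatedᵀ mixed isolated (suc x)))
hasDegree≥3-delete₀ mixed isolated (suc x , suc _ , suc _ , zero , _ , (_ , _ , a₃)) =
  ⊥-elim (a₃ (isolatedᵀ mixed isolated (suc x)))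
hasDegree≥3-delete₀ _ _ (suc x , suc y₁ , suc y₂ , suc y₃ , (y₁≢y₂ , y₁≢y₃ , y₂≢y₃) , adjacent) =
  x , y₁ , y₂ , y₃ , (y₁≢y₂ ∘ cong suc , y₁≢y₃ ∘ cong suc , y₂≢y₃ ∘ cong suc) , adjacent

hasDegree≥3-pad : (T : Labelling m) → ∀ k o (c : Vector (Fin m) n) →
                  HasDegree≥3 (blowUp T c) → HasDegree≥3 (blowUp T (pad k o c))
hasDegree≥3-pad T k o c = hasDegree≥3-map (k ↑ʳ_) (↑ʳ-injective k _ _) λ {x} {y} adjacent →
  adjacent ∘ trans (sym (blowUp-pad-↑ʳ T k o c x y))

¬hasDegree≥3-pad : {T : Labelling m} → IsMixedGraph T → ∀ o → (∀ j → T o j ≡ none) →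
                   ∀ k (c : Vector (Fin m) n) →
                   ¬ HasDegree≥3 (blowUp T c) → ¬ HasDegree≥3 (blowUp T (pad k o c))
¬hasDegree≥3-pad T-mixed o isolated zero    c ¬c = ¬c
¬hasDegree≥3-pad T-mixed o isolated (suc k) c ¬c = ¬hasDegree≥3-pad T-mixed o isolated k c ¬c
  ∘ hasDegree≥3-delete₀ (blowUp-isMixedGraph T-mixed _) (isolated ∘ _)

-- Switching equivalence preserves the underlying graph

switchLabel-none : ∀ l k → switchLabel l k ≡ none → l ≡ none
switchLabel-none none _ _ = refl
switchLabel-none und 0 ()
switchLabel-none und 1 ()
switchLabel-none und 2 ()
switchLabel-none und 3 ()
switchLabel-none und 4 ()
switchLabel-none und 5 ()
switchLabel-none und (suc (suc (suc (suc (suc (suc _)))))) ()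
switchLabel-none out 0 ()
switchLabel-none out 1 ()
switchLabel-none out 2 ()
switchLabel-none out 3 ()
switchLabel-none out 4 ()
switchLabel-none out 5 ()
switchLabel-none out (suc (suc (suc (suc (suc (suc _)))))) ()
switchLabel-none inn 0 ()
switchLabel-none inn 1 ()
switchLabel-none inn 2 ()
switchLabel-none inn 3 ()
switchLabel-none inn 4 ()
switchLabel-none inn 5 ()
switchLabel-none inn (suc (suc (suc (suc (suc (suc _)))))) ()

flipL-none : ∀ l → flipL l ≡ none → l ≡ none
flipL-none none _ = refl

step-preserves-hasDegree≥3 : {G H : Labelling n} → Step G H → HasDegree≥3 G → HasDegree≥3 H
step-preserves-hasDegree≥3 (switching _ _ H≡) = hasDegree≥3-map id id λ adjacent H≡none →
  adjacent (switchLabel-none _ _ (trans (sym (H≡ _ _)) H≡none))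
step-preserves-hasDegree≥3 (conv H≡) = hasDegree≥3-map id id λ adjacent H≡none →
  adjacent (flipL-none _ (trans (sym (H≡ _ _)) H≡none))
step-preserves-hasDegree≥3 (iso σ H≡) = hasDegree≥3-map (σ ⟨$⟩ʳ_) (Injection.injective (↔⇒↣ σ))
  λ adjacent H≡none → adjacent (trans (sym (H≡ _ _)) H≡none)

step-reflects-hasDegree≥3 : {G H : Labelling n} → Step G H → HasDegree≥3 H → HasDegree≥3 G
step-reflects-hasDegree≥3 (switching _ _ H≡) = hasDegree≥3-map id id λ adjacent G≡none →
  adjacent (trans (H≡ _ _) (cong (λ l → switchLabel l _) G≡none))
step-reflects-hasDegree≥3 (conv H≡) = hasDegree≥3-map id id λ adjacent G≡none →
  adjacent (trans (H≡ _ _) (cong flipL G≡none))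
step-reflects-hasDegree≥3 {H = H} (iso σ H≡) =
  hasDegree≥3-map (σ ⟨$⟩ˡ_) (Injection.injective (↔⇒↣ (flip σ))) λ adjacent G≡none →
    adjacent (trans (sym (cong₂ H (inverseʳ σ) (inverseʳ σ))) (trans (H≡ _ _) G≡none))

switchingEquivalent-reflects-hasDegree≥3 : {G H : Labelling n} → SwitchingEquivalent G H →
                                           HasDegree≥3 H → HasDegree≥3 G
switchingEquivalent-reflects-hasDegree≥3 (inj₁ G⟶H) =
  fold (λ G H → HasDegree≥3 H → HasDegree≥3 G) (λ step p → step-reflects-hasDegree≥3 step ∘ p) id G⟶H
switchingEquivalent-reflects-hasDegree≥3 (inj₂ H⟶G) =
  fold (λ H G → HasDegree≥3 H → HasDegree≥3 G) (λ step p → p ∘ step-preserves-hasDegree≥3 step) id H⟶G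

cospectralMate⇒¬determinedBySpectrum : (G H : Labelling n) → IsMixedGraph H → Cospectral G H →
  HasDegree≥3 H → ¬ HasDegree≥3 G → ¬ DeterminedBySpectrum G
cospectralMate⇒¬determinedBySpectrum G H mixed cospectral H-degree≥3 ¬G-degree≥3 determined =
  ¬G-degree≥3 (switchingEquivalent-reflects-hasDegree≥3 (determined H mixed cospectral) H-degree≥3)

-- C₄ ∪ (k + 1) K₁ and K₁,₄ ∪ k K₁, as blow-ups of K₂ ∪ K₁ whose class 0F is the isolated vertex.
squareClasses starClasses : Vector (Fin 3) 5
squareClasses = 1F ∷ 2F ∷ 1F ∷ 2F ∷ 0F ∷ []
starClasses   = 1F ∷ 2F ∷ 2F ∷ 2F ∷ 2F ∷ []

square star : (k : ℕ) → Labelling (k + 5)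
square k = blowUp K₂∪K₁ (pad k 0F squareClasses)
star   k = blowUp K₂∪K₁ (pad k 0F starClasses)

padded-isMixedGraph : ∀ k (c : Vector (Fin 3) n) → IsMixedGraph (blowUp K₂∪K₁ (pad k 0F c))
padded-isMixedGraph k c = blowUp-isMixedGraph K₂∪K₁-isMixedGraph (pad k 0F c)

square-star-cospectral₀ : Cospectral (blowUp K₂∪K₁ squareClasses) (blowUp K₂∪K₁ starClasses)
square-star-cospectral₀ = cospectral-fromCoefficients≤ (blowUp K₂∪K₁ squareClasses) (blowUp K₂∪K₁ starClasses)
  λ { 0F → refl ; 1F → refl ; 2F → refl ; 3F → refl ; 4F → refl ; 5F → refl }

square-star-cospectral : ∀ k → Cospectral (square k) (star k)
square-star-cospectral k =
  cospectral-pad K₂∪K₁ 0F (λ _ → refl) k square-star-cospectral₀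

square-rank : ∀ k → Rank (square k) 2
square-rank k =
  (ρ , ρ , ρ-injective , ρ-injective , nonzero) ,
  λ ρ κ _ _ → blowUp-K₂∪K₁-minor₃ (pad k 0F squareClasses) ρ κ
  where
  ρ : Fin 2 → Fin (k + 5)
  ρ i = k ↑ʳ (i ↑ˡ 3)

  ρ-injective : Injective _≡_ _≡_ ρ
  ρ-injective = Compose.injective _≡_ _≡_ _≡_ (↑ˡ-injective 3 _ _) (↑ʳ-injective k _ _)

  nonzero : minor 2 (N (square k)) ρ ρ ≢ 0E
  nonzero rewrite minor-pad K₂∪K₁ k 0F squareClasses 2 (_↑ˡ 3) (_↑ˡ 3) = λ ()

star-hasDegree≥3 : ∀ k → HasDegree≥3 (star k)
star-hasDegree≥3 k = hasDegree≥3-pad K₂∪K₁ k 0F starClasses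
  (toWitness {a? = hasDegree≥3? (blowUp K₂∪K₁ starClasses)} _)

square-¬hasDegree≥3 : ∀ k → ¬ HasDegree≥3 (square k)
square-¬hasDegree≥3 k = ¬hasDegree≥3-pad K₂∪K₁-isMixedGraph 0F (λ _ → refl) k squareClasses
  (toWitnessFalse {a? = hasDegree≥3? (blowUp K₂∪K₁ squareClasses)} _)

proposition5p11 : ∀ (m : ℕ) → ∃[ n ] ∃[ G ]
                    (m ≤ n × IsMixedGraph {n} G × Rank G 2 × ¬ DeterminedBySpectrum G)
proposition5p11 m =
  m + 5 , square m , m≤m+n m 5 , padded-isMixedGraph m squareClasses , square-rank m ,
  cospectralMate⇒¬determinedBySpectrum (square m) (star m) (padded-isMixedGraph m starClasses)
    (square-star-cospectral m) (star-hasDegree≥3 m) (square-¬hasDegree≥3 m)
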